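{- Let $k\ge 9$ be an integer and let $r,s$ be distinct elements of $\mathbb{Z}_{2k}$ such that $\Gamma=T_1(k,r,s)$ is a connected, simple, vertex-transitive graph. Then $\Gamma$ has girth at least $5$.
   Context: $T_1(k,r,s)$ is the graph with vertex set $\{u_i,v_i,w_i: i\in\mathbb{Z}_{2k}\}$ and edges $u_iu_{i+k}$, $u_iv_i$, $u_iw_i$, $v_iw_{i+r}$, $v_iw_{i+s}$ ($i\in\mathbb{Z}_{2k}$). -}

module Defs where

open import Data.Nat using (ℕ; zero; suc; _+_)
open import Data.Nat.DivMod using (_mod_)
open import Data.Fin using (Fin; toℕ)
open import Data.Product using (Σ; ∃; _×_; _,_)
open import Data.Sum using (_⊎_)
open import Relation.Nullary using (¬_)
open import Relation.Binary.PropositionalEquality using (_≡_; _≢_)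
open import Relation.Binary.Construct.Closure.ReflexiveTransitive using (Star)
open import Function.Bundles using (_↔_; Inverse)

addZ : (k : ℕ) → Fin (k + k) → ℕ → Fin (k + k)
addZ zero () j
addZ (suc k) i j = (toℕ i + j) mod (suc k + suc k)

data V (k : ℕ) : Set where
  u v w : Fin (k + k) → V k

-- the listed edges (one orientation each)
data E (k : ℕ) (r s : Fin (k + k)) : V k → V k → Set where
  uu : ∀ i → E k r s (u i) (u (addZ k i k))
  uv : ∀ i → E k r s (u i) (v i)
  uw : ∀ i → E k r s (u i) (w i)
  vwr : ∀ i → E k r s (v i) (w (addZ k i (toℕ r)))
  vws : ∀ i → E k r s (v i) (w (addZ k i (toℕ s)))

Adj : (k : ℕ) (r s : Fin (k + k)) → V k → V k → Set
Adj k r s x y = E k r s x y ⊎ E k r s y x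

-- simple: no loops and no repeated edges.  The only possible repeated
-- edge among the listed ones is v_i w_{i+r} = v_i w_{i+s}, i.e. r = s.
Simple : (k : ℕ) (r s : Fin (k + k)) → Set
Simple k r s = (∀ x → ¬ Adj k r s x x) × (∀ i → addZ k i (toℕ r) ≢ addZ k i (toℕ s))

Connected : (k : ℕ) (r s : Fin (k + k)) → Set
Connected k r s = ∀ (x y : V k) → Star (Adj k r s) x y

IsAut : (k : ℕ) (r s : Fin (k + k)) → (V k ↔ V k) → Set
IsAut k r s f = ∀ x y → (Adj k r s x y → Adj k r s (Inverse.to f x) (Inverse.to f y))
                      × (Adj k r s (Inverse.to f x) (Inverse.to f y) → Adj k r s x y)

VertexTransitive : (k : ℕ) (r s : Fin (k + k)) → Set
VertexTransitive k r s =
  ∀ (x y : V k) → Σ (V k ↔ V k) λ f → IsAut k r s f × (Inverse.to f x ≡ y)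

NoTriangle : (k : ℕ) (r s : Fin (k + k)) → Set
NoTriangle k r s = ∀ (a b c : V k) → a ≢ b → b ≢ c → a ≢ c →
  ¬ (Adj k r s a b × Adj k r s b c × Adj k r s c a)

NoSquare : (k : ℕ) (r s : Fin (k + k)) → Set
NoSquare k r s = ∀ (a b c d : V k) → a ≢ b → a ≢ c → a ≢ d → b ≢ c → b ≢ d → c ≢ d →
  ¬ (Adj k r s a b × Adj k r s b c × Adj k r s c d × Adj k r s d a)

GirthAtLeast5 : (k : ℕ) (r s : Fin (k + k)) → Set
GirthAtLeast5 k r s = NoTriangle k r s × NoSquare k r s

module Submission where

-- Vertex-transitivity reduces everything to one vertex (`homogeneous`): an
-- edge property preserved by automorphisms that holds on the edges at u₀
-- holds on every edge.  Near u₀ every vertex is x_{a·k+b·r+c·s} for x ∈ {u,v,w},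
-- so the neighbourhood is explored on symbolic vertices (kind, (a,b,c)).  A
-- normaliser encodes what is known about k, r, s and certifies equality and
-- distinctness of symbolic vertices; boolean searches over the finitely many
-- short walks are decided by evaluation, their soundness being proved once.
-- Generically (r, s ∉ {0,k}) no triangle or 4-cycle meets u₀.  If r ≡ k, every
-- edge at u₀ lies on a 4-cycle but v₀w_s does not; if r ≡ 0, every triangle
-- edge at u₀ starts a port walk back to u₀ but v₀w₀ does not: both contradict
-- vertex-transitivity.  Connectivity (`torsion`) rules out 2s ≡ 0, 3s ≡ k and
-- 4s ≡ 0 there, as 2k > 6.  The cases s ∈ {0,k} follow by the symmetry r ↔ s.

open import Defs
open import Data.Nat using (ℕ; _≤_; _+_)
open import Data.Fin using (Fin)
open import Relation.Binary.PropositionalEquality using (_≢_)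

import Data.Nat as ℕ
import Data.Nat.Properties as ℕP
import Data.Nat.Divisibility as ℕD
open import Data.Integer as ℤ
  using (ℤ; +_; -_; 0ℤ; 1ℤ; -1ℤ; ∣_∣; _%ℕ_; _/ℕ_)
  renaming (_+_ to _⊹_; _*_ to _·_; _-_ to _−_)
import Data.Integer.Properties as ℤP
open import Data.Integer.DivMod using (n%ℕd<d; a≡a%ℕn+[a/ℕn]*n)
open import Data.Integer.Divisibility.Signed
  using (_∣_; divides; ∣m∣n⇒∣m+n; ∣m⇒∣-m; ∣n⇒∣m*n; ∣⇒∣ᵤ)
open import Data.Integer.Tactic.RingSolver using (solve-∀)
open import Data.Fin using (toℕ; fromℕ<)
import Data.Fin.Properties as FP
open import Data.Bool using (Bool; true; false; T; _∧_; _∨_)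
open import Data.Bool.Properties using (T-∧; T-∨)
open import Data.Bool.ListAction using (all; any)
open import Data.Product using (Σ; _×_; _,_; proj₁; proj₂; uncurry)
open import Data.Product.Properties using (≡-dec)
open import Data.Sum using (_⊎_; inj₁; inj₂)
import Data.Sum
open import Data.Empty using (⊥-elim)
open import Data.List using (List; []; _∷_; map)
open import Data.List.Membership.Propositional using (_∈_; find)
open import Data.List.Membership.Propositional.Properties using (∈-map⁻)
open import Data.List.Relation.Unary.Any using (Any; here; there)
open import Data.List.Relation.Unary.All as All using (All; []; _∷_)
import Data.List.Relation.Unary.All.Properties as AllP
open import Function.Base using (_∘_)
open import Function.Bundles using (_↔_; Inverse; Equivalence)
open import Function.Construct.Symmetry using (↔-sym)
open import Level using (0ℓ)
open import Relation.Nullary using (¬_; Dec; yes; no)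
open import Relation.Nullary.Decidable using (isYes; toWitness)
open import Relation.Binary.Bundles using (Setoid)
import Relation.Binary.Reasoning.Setoid as SetoidReasoning
open import Relation.Binary.Construct.Closure.ReflexiveTransitive as Star using (Star; ε; _◅_)
open import Relation.Binary.PropositionalEquality
  using (_≡_; refl; sym; trans; cong; cong₂; subst; subst₂; module ≡-Reasoning)

module Residues (n : ℕ) .{{_ : ℕ.NonZero n}} where

  N : ℤ
  N = + n

  infix 4 _≋_
  record _≋_ (x y : ℤ) : Set where
    constructor congruent
    field divides-difference : N ∣ x − y

  ∣-resp : ∀ {x y} → x ≡ y → N ∣ x → N ∣ y
  ∣-resp = subst (N ∣_)

  ≋-refl : ∀ {x} → x ≋ x
  ≋-refl {x} = congruent (divides 0ℤ (trans (ℤP.+-inverseʳ x) (sym (ℤP.*-zeroˡ N))))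

  ≋-sym : ∀ {x y} → x ≋ y → y ≋ x
  ≋-sym {x} {y} (congruent p) = congruent (∣-resp (lemma x y) (∣m⇒∣-m p))
    where
    lemma : ∀ x y → - (x − y) ≡ y − x
    lemma = solve-∀

  ≋-trans : ∀ {x y z} → x ≋ y → y ≋ z → x ≋ z
  ≋-trans {x} {y} {z} (congruent p) (congruent q) =
    congruent (∣-resp (lemma x y z) (∣m∣n⇒∣m+n p q))
    where
    lemma : ∀ x y z → (x − y) ⊹ (y − z) ≡ x − z
    lemma = solve-∀

  ≋-reflexive : ∀ {x y} → x ≡ y → x ≋ y
  ≋-reflexive refl = ≋-refl

  ≋-+ : ∀ {x x′ y y′} → x ≋ x′ → y ≋ y′ → x ⊹ y ≋ x′ ⊹ y′
  ≋-+ {x} {x′} {y} {y′} (congruent p) (congruent q) =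
    congruent (∣-resp (lemma x x′ y y′) (∣m∣n⇒∣m+n p q))
    where
    lemma : ∀ x x′ y y′ → (x − x′) ⊹ (y − y′) ≡ (x ⊹ y) − (x′ ⊹ y′)
    lemma = solve-∀

  ≋-* : ∀ c {x y} → x ≋ y → c · x ≋ c · y
  ≋-* c {x} {y} (congruent p) = congruent (∣-resp (lemma c x y) (∣n⇒∣m*n c p))
    where
    lemma : ∀ c x y → c · (x − y) ≡ c · x − c · y
    lemma = solve-∀

  ≋-setoid : Setoid 0ℓ 0ℓ
  ≋-setoid = record
    { Carrier = ℤ ; _≈_ = _≋_
    ; isEquivalence = record { refl = ≋-refl ; sym = ≋-sym ; trans = ≋-trans } }

  module ≋-Reasoning = SetoidReasoning ≋-setoid

  N≋0 : N ≋ 0ℤ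
  N≋0 = congruent (divides 1ℤ (trans (ℤP.+-identityʳ N) (sym (ℤP.*-identityˡ N))))

  difference≋0 : ∀ {x y} → x ≋ y → x − y ≋ 0ℤ
  difference≋0 {x} {y} (congruent p) = congruent (∣-resp (sym (ℤP.+-identityʳ (x − y))) p)

  difference≋0⁻¹ : ∀ {x y} → x − y ≋ 0ℤ → x ≋ y
  difference≋0⁻¹ {x} {y} (congruent p) = congruent (∣-resp (ℤP.+-identityʳ (x − y)) p)

  small-multiple : ∀ {m} → m ℕ.< n → n ℕD.∣ m → m ≡ 0
  small-multiple {ℕ.zero} _ _ = refl
  small-multiple {ℕ.suc m} m<n n∣m =
    ⊥-elim (ℕP.<-irrefl refl (ℕP.<-≤-trans m<n (ℕD.∣⇒≤ n∣m)))

  nonzero-residue : ∀ {m} → 0 ℕ.< m → m ℕ.< n → ¬ + m ≋ 0ℤ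
  nonzero-residue {m} 0<m m<n (congruent N∣m) =
    ℕP.<-irrefl (sym (small-multiple m<n (∣⇒∣ᵤ (∣-resp (ℤP.+-identityʳ (+ m)) N∣m)))) 0<m

  residue-unique≤ : ∀ {a b} → a ℕ.≤ b → b ℕ.< n → + a ≋ + b → a ≡ b
  residue-unique≤ {a} {b} a≤b b<n a≋b =
    ℕP.≤-antisym a≤b (ℕP.m∸n≡0⇒m≤n (small-multiple b∸a<n n∣b∸a))
    where
    b∸a<n : b ℕ.∸ a ℕ.< n
    b∸a<n = ℕP.≤-<-trans (ℕP.m∸n≤m b a) b<n
    n∣b∸a : n ℕD.∣ b ℕ.∸ a
    n∣b∸a = subst (n ℕD.∣_) (trans (cong ∣_∣ (ℤP.m-n≡m⊖n a b)) (ℤP.∣⊖∣-≤ a≤b))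
                  (∣⇒∣ᵤ (_≋_.divides-difference a≋b))

  residue-unique : ∀ {a b} → a ℕ.< n → b ℕ.< n → + a ≋ + b → a ≡ b
  residue-unique {a} {b} a<n b<n a≋b with ℕP.≤-total a b
  ... | inj₁ a≤b = residue-unique≤ a≤b b<n a≋b
  ... | inj₂ b≤a = sym (residue-unique≤ b≤a a<n (≋-sym a≋b))

  residue-≢ : ∀ {a b} → a ℕ.< n → b ℕ.< n → a ≢ b → ¬ + a ≋ + b
  residue-≢ a<n b<n a≢b a≋b = a≢b (residue-unique a<n b<n a≋b)

  ι : Fin n → ℤ
  ι i = + toℕ i

  idx : ℤ → Fin n
  idx x = fromℕ< (n%ℕd<d x n)

  ι-idx : ∀ x → ι (idx x) ≋ x
  ι-idx x = congruent (divides (- (x /ℕ n)) (begin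
      ι (idx x) − x
        ≡⟨ cong₂ _−_ (cong +_ (FP.toℕ-fromℕ< (n%ℕd<d x n))) (a≡a%ℕn+[a/ℕn]*n x n) ⟩
      + (x %ℕ n) − (+ (x %ℕ n) ⊹ (x /ℕ n) · N)
        ≡⟨ lemma (+ (x %ℕ n)) (x /ℕ n) N ⟩
      - (x /ℕ n) · N ∎))
    where
    open ≡-Reasoning
    lemma : ∀ r q m → r − (r ⊹ q · m) ≡ - q · m
    lemma = solve-∀

  ι-injective : ∀ {i j} → ι i ≋ ι j → i ≡ j
  ι-injective {i} {j} p = FP.toℕ-injective (residue-unique (FP.toℕ<n i) (FP.toℕ<n j) p)

  idx-cong : ∀ {x y} → x ≋ y → idx x ≡ idx y
  idx-cong {x} {y} p = ι-injective (≋-trans (ι-idx x) (≋-trans p (≋-sym (ι-idx y))))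

  idx-injective : ∀ {x y} → idx x ≡ idx y → x ≋ y
  idx-injective {x} {y} eq =
    ≋-trans (≋-sym (ι-idx x)) (≋-trans (≋-reflexive (cong ι eq)) (ι-idx y))

split : ∀ {a b} → T (a ∧ b) → T a × T b
split = Equivalence.to T-∧

cases : ∀ {a b} → T (a ∨ b) → T a ⊎ T b
cases = Equivalence.to T-∨

T-all : ∀ {A : Set} (p : A → Bool) xs → T (all p xs) → All (T ∘ p) xs
T-all p []       _ = []
T-all p (x ∷ xs) h = proj₁ (split h) ∷ T-all p xs (proj₂ (split h))

T-any : ∀ {A : Set} (p : A → Bool) xs → T (any p xs) → Any (T ∘ p) xs
T-any p (x ∷ xs) h with cases h
... | inj₁ px  = here px
... | inj₂ pxs = there (T-any p xs pxs)

module Local {k : ℕ} {r s : Fin (k + k)} where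

  G : V k → V k → Set
  G = Adj k r s

  adj-sym : ∀ {a b} → G a b → G b a
  adj-sym = Data.Sum.swap

  -- a and b have a common neighbour (for an edge a b: it lies on a triangle)
  CommonNbr : V k → V k → Set
  CommonNbr a b = Σ (V k) λ c → G a c × G c b

  OnSquare : V k → V k → Set
  OnSquare a b = Σ (V k) λ c → Σ (V k) λ d →
    a ≢ b × a ≢ c × a ≢ d × b ≢ c × b ≢ d × c ≢ d × G b c × G c d × G d a

  -- When every vertex lies on a triangle, the edges with no common neighbour
  -- of their ends form a perfect matching.  A port walk alternates such
  -- matching edges with non-backtracking steps: it leaves a along a matching
  -- edge, turns at the next vertex to a vertex c ≠ a, and so on, m times,
  -- finishing with a matching edge.
  data PortWalk : ℕ → V k → V k → Set where
    exit : ∀ {a b} → ¬ CommonNbr a b → G a b → PortWalk 0 a b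
    turn : ∀ {m a b c d} → ¬ CommonNbr a b → G a b → G b c → a ≢ c →
           PortWalk m c d → PortWalk (ℕ.suc m) a d

  noTriangle-from : (∀ a b → G a b → ¬ CommonNbr a b) → NoTriangle k r s
  noTriangle-from none a b c _ _ _ (ab , bc , ca) =
    none a b ab (c , adj-sym ca , adj-sym bc)

  noSquare-from : (∀ a b → G a b → ¬ OnSquare a b) → NoSquare k r s
  noSquare-from none a b c d ab ac ad bc bd cd (gab , gbc , gcd , gda) =
    none a b gab (c , d , ab , ac , ad , bc , bd , cd , gbc , gcd , gda)

  Invariant : (V k → V k → Set) → Set
  Invariant P = ∀ f → IsAut k r s f → ∀ {a b} → P a b → P (Inverse.to f a) (Inverse.to f b)

  module _ (f : V k ↔ V k) (aut : IsAut k r s f) where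
    open Inverse f using (to; from; strictlyInverseˡ; strictlyInverseʳ)

    preserves-adj : ∀ {a b} → G a b → G (to a) (to b)
    preserves-adj = proj₁ (aut _ _)

    preserves-≢ : ∀ {a b} → a ≢ b → to a ≢ to b
    preserves-≢ {a} {b} a≢b eq = a≢b (begin
      a            ≡⟨ strictlyInverseʳ a ⟨
      from (to a)  ≡⟨ cong from eq ⟩
      from (to b)  ≡⟨ strictlyInverseʳ b ⟩
      b            ∎)
      where open ≡-Reasoning

    inverse-aut : IsAut k r s (↔-sym f)
    inverse-aut a b = reflect , λ h → back (proj₁ (aut (from a) (from b)) h)
      where
      back : G (to (from a)) (to (from b)) → G a b
      back = subst₂ G (strictlyInverseˡ a) (strictlyInverseˡ b)
      reflect : G a b → G (from a) (from b)
      reflect h = proj₂ (aut (from a) (from b))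
                    (subst₂ G (sym (strictlyInverseˡ a)) (sym (strictlyInverseˡ b)) h)

    reflects : ∀ {P} → Invariant P → ∀ {a b} → P (to a) (to b) → P a b
    reflects {P} inv {a} {b} p =
      subst₂ P (strictlyInverseʳ a) (strictlyInverseʳ b) (inv (↔-sym f) inverse-aut p)

  ¬-invariant : ∀ {P} → Invariant P → Invariant (λ a b → ¬ P a b)
  ¬-invariant inv f aut ¬p p = ¬p (reflects f aut inv p)

  →-invariant : ∀ {P Q} → Invariant P → Invariant Q → Invariant (λ a b → P a b → Q a b)
  →-invariant invP invQ f aut p⇒q p = invQ f aut (p⇒q (reflects f aut invP p))

  flip-invariant : ∀ {P} → Invariant P → Invariant (λ a b → P b a)
  flip-invariant inv f aut = inv f aut

  commonNbr-invariant : Invariant CommonNbr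
  commonNbr-invariant f aut (c , ac , cb) =
    Inverse.to f c , preserves-adj f aut ac , preserves-adj f aut cb

  onSquare-invariant : Invariant OnSquare
  onSquare-invariant f aut (c , d , ab , ac , ad , bc , bd , cd , gbc , gcd , gda) =
    Inverse.to f c , Inverse.to f d ,
    ≢ ab , ≢ ac , ≢ ad , ≢ bc , ≢ bd , ≢ cd , adj gbc , adj gcd , adj gda
    where
    ≢ : ∀ {x y} → x ≢ y → Inverse.to f x ≢ Inverse.to f y
    ≢ = preserves-≢ f aut
    adj : ∀ {x y} → G x y → G (Inverse.to f x) (Inverse.to f y)
    adj = preserves-adj f aut

  portWalk-invariant : ∀ m → Invariant (PortWalk m)
  portWalk-invariant _ f aut (exit ncn ab) =
    exit (¬-invariant commonNbr-invariant f aut ncn) (preserves-adj f aut ab)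
  portWalk-invariant (ℕ.suc m) f aut (turn ncn ab bc a≢c walk) =
    turn (¬-invariant commonNbr-invariant f aut ncn) (preserves-adj f aut ab)
         (preserves-adj f aut bc) (preserves-≢ f aut a≢c) (portWalk-invariant m f aut walk)

  homogeneous : VertexTransitive k r s → ∀ {P} → Invariant P → ∀ x₀ →
    (∀ y → G x₀ y → P x₀ y) → ∀ x y → G x y → P x y
  homogeneous vt {P} inv x₀ local x y xy with vt x x₀
  ... | f , aut , refl = reflects f aut inv (local (Inverse.to f y) (preserves-adj f aut xy))

-- The index of a vertex of T₁(k,r,s) is described by a
-- coefficient vector (a , b , c), standing for a·k + b·r + c·s; its kind says
-- whether it is a u-, v- or w-vertex.  Everything in this part is closed
-- syntax, so the boolean checks below are decided by evaluation.
data Kind : Set where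
  ku kv kw : Kind

_≟ᵏ_ : (p q : Kind) → Dec (p ≡ q)
ku ≟ᵏ ku = yes refl
kv ≟ᵏ kv = yes refl
kw ≟ᵏ kw = yes refl
ku ≟ᵏ kv = no λ ()
ku ≟ᵏ kw = no λ ()
kv ≟ᵏ ku = no λ ()
kv ≟ᵏ kw = no λ ()
kw ≟ᵏ ku = no λ ()
kw ≟ᵏ kv = no λ ()

Coeffs : Set
Coeffs = ℤ × ℤ × ℤ

_≟ᶜ_ : (d e : Coeffs) → Dec (d ≡ e)
_≟ᶜ_ = ≡-dec ℤ._≟_ (≡-dec ℤ._≟_ ℤ._≟_)

infixl 6 _+ᶜ_ _-ᶜ_
_+ᶜ_ _-ᶜ_ : Coeffs → Coeffs → Coeffs
(a , b , c) +ᶜ (a′ , b′ , c′) = a ⊹ a′ , b ⊹ b′ , c ⊹ c′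
(a , b , c) -ᶜ (a′ , b′ , c′) = a − a′ , b − b′ , c − c′

𝟎 eK eR eS : Coeffs
𝟎 = 0ℤ , 0ℤ , 0ℤ
eK = 1ℤ , 0ℤ , 0ℤ
eR = 0ℤ , 1ℤ , 0ℤ
eS = 0ℤ , 0ℤ , 1ℤ

data SymV : Set where
  sv : Kind → Coeffs → SymV

nbrs : SymV → List SymV
nbrs (sv ku d) = sv ku (d +ᶜ eK) ∷ sv kv d ∷ sv kw d ∷ []
nbrs (sv kv d) = sv ku d ∷ sv kw (d +ᶜ eR) ∷ sv kw (d +ᶜ eS) ∷ []
nbrs (sv kw d) = sv ku d ∷ sv kv (d -ᶜ eR) ∷ sv kv (d -ᶜ eS) ∷ []

-- A normaliser encodes what is known about k, r, s in one case of the proof: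
-- `reduce` maps a coefficient vector to a canonical one with the same value
-- modulo 2k, and `facts` lists vectors whose value is known to be nonzero.
record Normaliser : Set where
  field
    reduce : Coeffs → Coeffs
    facts  : List Coeffs

parity : ℤ → ℤ
parity a = + (a %ℕ 2)

module Checks (nm : Normaliser) where
  open Normaliser nm
  open import Data.List.Membership.DecPropositional _≟ᶜ_ using (_∈?_)

  vanishes known : Coeffs → Bool
  vanishes d = isYes (reduce d ≟ᶜ 𝟎)
  known d = isYes (reduce d ∈? map reduce facts)

  sameKinds apartKinds : ∀ {p q : Kind} → Dec (p ≡ q) → Coeffs → Coeffs → Bool
  sameKinds (yes _) d e = vanishes (d -ᶜ e)
  sameKinds (no _)  d e = false
  apartKinds (yes _) d e = known (d -ᶜ e) ∨ known (e -ᶜ d)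
  apartKinds (no _)  d e = true

  same apart : SymV → SymV → Bool
  same (sv p d) (sv q e) = sameKinds (p ≟ᵏ q) d e
  apart (sv p d) (sv q e) = apartKinds (p ≟ᵏ q) d e

  commonNbr : SymV → SymV → Bool
  commonNbr x y = any (λ c → any (λ y′ → same y′ y) (nbrs c)) (nbrs x)

  noCommonNbr : SymV → SymV → Bool
  noCommonNbr x y = all (λ c → all (λ y′ → apart y′ y) (nbrs c)) (nbrs x)

  someSame allApart : List (SymV × SymV) → Bool
  someSame = any (uncurry same)
  allApart = all (uncurry apart)

  squareOn : SymV → SymV → Bool
  squareOn x y = any (λ c → any (λ d → closes d ∧ allApart (pairs c d)) (nbrs c)) (nbrs y)
    where
    closes : SymV → Bool
    closes d = any (λ x′ → same x′ x) (nbrs d)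
    pairs : SymV → SymV → List (SymV × SymV)
    pairs c d = (x , y) ∷ (x , c) ∷ (x , d) ∷ (y , c) ∷ (y , d) ∷ (c , d) ∷ []

  noSquareOn : SymV → SymV → Bool
  noSquareOn x y = all (λ c → all (λ d → someSame (pairs c d) ∨ opens d) (nbrs c)) (nbrs y)
    where
    opens : SymV → Bool
    opens d = all (λ x′ → apart x′ x) (nbrs d)
    pairs : SymV → SymV → List (SymV × SymV)
    pairs c d = (x , c) ∷ (y , c) ∷ (x , d) ∷ (y , d) ∷ (c , d) ∷ []

  portWalk : ℕ → SymV → SymV → Bool
  portWalk ℕ.zero    x y = any (λ z → noCommonNbr x z ∧ same z y) (nbrs x)
  portWalk (ℕ.suc m) x y =
    any (λ z → noCommonNbr x z ∧ any (λ t → apart x t ∧ portWalk m t y) (nbrs z)) (nbrs x)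

  noPortWalk : ℕ → SymV → SymV → Bool
  noPortWalk ℕ.zero    x y = all (λ z → commonNbr x z ∨ apart z y) (nbrs x)
  noPortWalk (ℕ.suc m) x y =
    all (λ z → commonNbr x z ∨ all (λ t → same x t ∨ noPortWalk m t y) (nbrs z)) (nbrs x)

-- Generically only 2k ≡ 0 is known, so
-- the coefficient of k is reduced modulo 2.  When r ≡ k the r-coefficient
-- is merged into the k-coefficient, and when r ≡ 0 it is dropped.
normaliser-generic normaliser-r≡k normaliser-r≡0 : Normaliser
normaliser-generic = record
  { reduce = λ { (a , b , c) → parity a , b , c }
  ; facts  = eK ∷ eR ∷ eS ∷ eR -ᶜ eK ∷ eS -ᶜ eK ∷ eR -ᶜ eS ∷ [] }
normaliser-r≡k = record
  { reduce = λ { (a , b , c) → parity (a ⊹ b) , 0ℤ , c }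
  ; facts  = eK ∷ eS ∷ eS -ᶜ eK ∷ eS +ᶜ eS ∷ [] }
normaliser-r≡0 = record
  { reduce = λ { (a , b , c) → parity a , 0ℤ , c }
  ; facts  = eK ∷ eS ∷ eS +ᶜ eS +ᶜ eS -ᶜ eK ∷ eS +ᶜ eS +ᶜ eS +ᶜ eS ∷ [] }

module Model (k′ : ℕ) (r s : Fin (ℕ.suc k′ + ℕ.suc k′)) where

  k n : ℕ
  k = ℕ.suc k′
  n = k + k

  open Residues n public
  open Local {k} {r} {s} public

  K R S : ℤ
  K = + k
  R = ι r
  S = ι s

  N≡K+K : N ≡ K ⊹ K
  N≡K+K = ℤP.pos-+ k k

  L : Coeffs → ℤ
  L (a , b , c) = a · K ⊹ b · R ⊹ c · S

  L-+ᶜ : ∀ d e → L (d +ᶜ e) ≡ L d ⊹ L e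
  L-+ᶜ (a , b , c) (a′ , b′ , c′) = lemma a b c a′ b′ c′ K R S
    where
    lemma : ∀ a b c a′ b′ c′ K R S →
      (a ⊹ a′) · K ⊹ (b ⊹ b′) · R ⊹ (c ⊹ c′) · S ≡
      (a · K ⊹ b · R ⊹ c · S) ⊹ (a′ · K ⊹ b′ · R ⊹ c′ · S)
    lemma = solve-∀

  L--ᶜ : ∀ d e → L (d -ᶜ e) ≡ L d − L e
  L--ᶜ (a , b , c) (a′ , b′ , c′) = lemma a b c a′ b′ c′ K R S
    where
    lemma : ∀ a b c a′ b′ c′ K R S →
      (a − a′) · K ⊹ (b − b′) · R ⊹ (c − c′) · S ≡
      (a · K ⊹ b · R ⊹ c · S) − (a′ · K ⊹ b′ · R ⊹ c′ · S)
    lemma = solve-∀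

  L-difference : ∀ d e → L d ≋ L e → L (d -ᶜ e) ≋ 0ℤ
  L-difference d e d≋e = subst (_≋ 0ℤ) (sym (L--ᶜ d e)) (difference≋0 d≋e)

  L-difference⁻¹ : ∀ d e → L (d -ᶜ e) ≋ 0ℤ → L d ≋ L e
  L-difference⁻¹ d e d-e≋0 = difference≋0⁻¹ (subst (_≋ 0ℤ) (L--ᶜ d e) d-e≋0)

  L-eK : L eK ≡ K
  L-eK = lemma K R S
    where
    lemma : ∀ K R S → 1ℤ · K ⊹ 0ℤ · R ⊹ 0ℤ · S ≡ K
    lemma = solve-∀

  L-eR : L eR ≡ R
  L-eR = lemma K R S
    where
    lemma : ∀ K R S → 0ℤ · K ⊹ 1ℤ · R ⊹ 0ℤ · S ≡ R
    lemma = solve-∀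

  L-eS : L eS ≡ S
  L-eS = lemma K R S
    where
    lemma : ∀ K R S → 0ℤ · K ⊹ 0ℤ · R ⊹ 1ℤ · S ≡ S
    lemma = solve-∀

  infixl 6 _⊞_
  _⊞_ : Fin n → ℤ → Fin n
  i ⊞ x = idx (ι i ⊹ x)

  addZ-⊞ : ∀ i j → addZ k i j ≡ i ⊞ + j
  addZ-⊞ i j = trans (FP.toℕ-injective (trans (FP.toℕ-fromℕ< _) (sym (FP.toℕ-fromℕ< _))))
                     (cong idx (ℤP.pos-+ (toℕ i) j))

  ⊞-inverse : ∀ i x y → x ⊹ y ≋ 0ℤ → i ⊞ x ⊞ y ≡ i
  ⊞-inverse i x y x+y≋0 = ι-injective (begin
    ι (i ⊞ x ⊞ y)   ≈⟨ ι-idx _ ⟩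
    ι (i ⊞ x) ⊹ y   ≈⟨ ≋-+ (ι-idx (ι i ⊹ x)) (≋-refl {y}) ⟩
    ι i ⊹ x ⊹ y     ≡⟨ ℤP.+-assoc (ι i) x y ⟩
    ι i ⊹ (x ⊹ y)   ≈⟨ ≋-+ (≋-refl {ι i}) x+y≋0 ⟩
    ι i ⊹ 0ℤ        ≡⟨ ℤP.+-identityʳ (ι i) ⟩
    ι i             ∎)
    where open ≋-Reasoning

  undo-addZ : ∀ i j x → + j ⊹ x ≋ 0ℤ → addZ k i j ⊞ x ≡ i
  undo-addZ i j x j+x≋0 = trans (cong (_⊞ x) (addZ-⊞ i j)) (⊞-inverse i (+ j) x j+x≋0)

  addZ-undo : ∀ i j x → x ⊹ + j ≋ 0ℤ → addZ k (i ⊞ x) j ≡ i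
  addZ-undo i j x x+j≋0 = trans (addZ-⊞ (i ⊞ x) j) (⊞-inverse i x (+ j) x+j≋0)

  K+K≋0 : K ⊹ K ≋ 0ℤ
  K+K≋0 = subst (_≋ 0ℤ) N≡K+K N≋0

  x-x≋0 : ∀ x → x ⊹ - x ≋ 0ℤ
  x-x≋0 x = ≋-reflexive (ℤP.+-inverseʳ x)

  -x+x≋0 : ∀ x → - x ⊹ x ≋ 0ℤ
  -x+x≋0 x = ≋-reflexive (ℤP.+-inverseˡ x)

  realNbrs : V k → List (V k)
  realNbrs (u i) = u (i ⊞ K) ∷ v i ∷ w i ∷ []
  realNbrs (v i) = u i ∷ w (i ⊞ R) ∷ w (i ⊞ S) ∷ []
  realNbrs (w i) = u i ∷ v (i ⊞ - R) ∷ v (i ⊞ - S) ∷ []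

  adj⇒realNbr : ∀ {a y} → G a y → y ∈ realNbrs a
  adj⇒realNbr (inj₁ (uu i))  = here (cong u (addZ-⊞ i k))
  adj⇒realNbr (inj₁ (uv i))  = there (here refl)
  adj⇒realNbr (inj₁ (uw i))  = there (there (here refl))
  adj⇒realNbr (inj₁ (vwr i)) = there (here (cong w (addZ-⊞ i (toℕ r))))
  adj⇒realNbr (inj₁ (vws i)) = there (there (here (cong w (addZ-⊞ i (toℕ s)))))
  adj⇒realNbr (inj₂ (uu i))  = here (cong u (sym (undo-addZ i k K K+K≋0)))
  adj⇒realNbr (inj₂ (uv i))  = here refl
  adj⇒realNbr (inj₂ (uw i))  = here refl
  adj⇒realNbr (inj₂ (vwr i)) =
    there (here (cong v (sym (undo-addZ i (toℕ r) (- R) (x-x≋0 R)))))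
  adj⇒realNbr (inj₂ (vws i)) =
    there (there (here (cong v (sym (undo-addZ i (toℕ s) (- S) (x-x≋0 S))))))

  realNbr⇒adj : ∀ a → All (G a) (realNbrs a)
  realNbr⇒adj (u i) =
    inj₁ (subst (λ j → E k r s (u i) (u j)) (addZ-⊞ i k) (uu i)) ∷ inj₁ (uv i) ∷ inj₁ (uw i) ∷ []
  realNbr⇒adj (v i) =
    inj₂ (uv i) ∷ inj₁ (subst (λ j → E k r s (v i) (w j)) (addZ-⊞ i (toℕ r)) (vwr i)) ∷
    inj₁ (subst (λ j → E k r s (v i) (w j)) (addZ-⊞ i (toℕ s)) (vws i)) ∷ []
  realNbr⇒adj (w i) =
    inj₂ (uw i) ∷
    inj₂ (subst (λ j → E k r s (v (i ⊞ - R)) (w j))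
                (addZ-undo i (toℕ r) (- R) (-x+x≋0 R)) (vwr (i ⊞ - R))) ∷
    inj₂ (subst (λ j → E k r s (v (i ⊞ - S)) (w j))
                (addZ-undo i (toℕ s) (- S) (-x+x≋0 S)) (vws (i ⊞ - S))) ∷ []

  vertex : Kind → Fin n → V k
  vertex ku = u
  vertex kv = v
  vertex kw = w

  ⟦_⟧ : SymV → V k
  ⟦ sv p d ⟧ = vertex p (idx (L d))

  vertex-injective : ∀ p q {i j} → vertex p i ≡ vertex q j → p ≡ q × i ≡ j
  vertex-injective ku ku refl = refl , refl
  vertex-injective kv kv refl = refl , refl
  vertex-injective kw kw refl = refl , refl
  vertex-injective ku kv ()
  vertex-injective ku kw ()
  vertex-injective kv ku ()
  vertex-injective kv kw ()
  vertex-injective kw ku ()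
  vertex-injective kw kv ()

  ⟦⟧-injective : ∀ p q d e → ⟦ sv p d ⟧ ≡ ⟦ sv q e ⟧ → p ≡ q × L d ≋ L e
  ⟦⟧-injective p q d e eq with vertex-injective p q eq
  ... | p≡q , i≡j = p≡q , idx-injective i≡j

  ⟦⟧-cong : ∀ p d e → L d ≋ L e → ⟦ sv p d ⟧ ≡ ⟦ sv p e ⟧
  ⟦⟧-cong p d e d≋e = cong (vertex p) (idx-cong d≋e)

  shift-L : ∀ d e x → L e ≡ L d ⊹ x → idx (L d) ⊞ x ≡ idx (L e)
  shift-L d e x eq = idx-cong (≋-trans (≋-+ (ι-idx (L d)) (≋-refl {x})) (≋-reflexive (sym eq)))

  shift-+ : ∀ d e x → L e ≡ x → idx (L d) ⊞ x ≡ idx (L (d +ᶜ e))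
  shift-+ d e x eq = shift-L d (d +ᶜ e) x (trans (L-+ᶜ d e) (cong (L d ⊹_) eq))

  shift-− : ∀ d e x → L e ≡ x → idx (L d) ⊞ - x ≡ idx (L (d -ᶜ e))
  shift-− d e x eq = shift-L d (d -ᶜ e) (- x) (trans (L--ᶜ d e) (cong (λ y → L d − y) eq))

  realNbrs-⟦⟧ : ∀ x → realNbrs ⟦ x ⟧ ≡ map ⟦_⟧ (nbrs x)
  realNbrs-⟦⟧ (sv ku d) = cong (λ i → u i ∷ v j ∷ w j ∷ []) (shift-+ d eK K L-eK)
    where
    j : Fin n
    j = idx (L d)
  realNbrs-⟦⟧ (sv kv d) =
    cong₂ (λ i i′ → u j ∷ w i ∷ w i′ ∷ []) (shift-+ d eR R L-eR) (shift-+ d eS S L-eS)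
    where
    j : Fin n
    j = idx (L d)
  realNbrs-⟦⟧ (sv kw d) =
    cong₂ (λ i i′ → u j ∷ v i ∷ v i′ ∷ []) (shift-− d eR R L-eR) (shift-− d eS S L-eS)
    where
    j : Fin n
    j = idx (L d)

  adj-nbrs : ∀ x {y} → G ⟦ x ⟧ y → Σ SymV λ t → t ∈ nbrs x × y ≡ ⟦ t ⟧
  adj-nbrs x h = ∈-map⁻ ⟦_⟧ (subst (_ ∈_) (realNbrs-⟦⟧ x) (adj⇒realNbr h))

  nbrs-adj : ∀ x → All (λ t → G ⟦ x ⟧ ⟦ t ⟧) (nbrs x)
  nbrs-adj x = AllP.map⁻ (subst (All (G ⟦ x ⟧)) (realNbrs-⟦⟧ x) (realNbr⇒adj ⟦ x ⟧))

  each-nbr : ∀ {p} x {y} → T (all p (nbrs x)) → G ⟦ x ⟧ y →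
             Σ SymV λ t → y ≡ ⟦ t ⟧ × T (p t)
  each-nbr {p} x h xy with adj-nbrs x xy
  ... | t , t∈ , y≡t = t , y≡t , All.lookup (T-all p (nbrs x) h) t∈

  some-nbr : ∀ {p} x → T (any p (nbrs x)) → Σ SymV λ t → G ⟦ x ⟧ ⟦ t ⟧ × T (p t)
  some-nbr {p} x h with find (T-any p (nbrs x) h)
  ... | t , t∈ , pt = t , All.lookup (nbrs-adj x) t∈ , pt

  record Sound (nm : Normaliser) : Set where
    open Normaliser nm
    field
      reduce-sound : ∀ d → L (reduce d) ≋ L d
      facts-sound  : All (λ e → ¬ L e ≋ 0ℤ) facts

  module Soundness {nm : Normaliser} (sound : Sound nm) where
    open Normaliser nm
    open Sound sound
    open Checks nm

    vanishes-sound : ∀ d → T (vanishes d) → L d ≋ 0ℤ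
    vanishes-sound d h = ≋-trans (≋-sym (reduce-sound d)) (≋-reflexive (cong L (toWitness h)))

    known-sound : ∀ d → T (known d) → ¬ L d ≋ 0ℤ
    known-sound d h Ld≋0 with ∈-map⁻ reduce (toWitness h)
    ... | e , e∈facts , d≡e = All.lookup facts-sound e∈facts (begin
      L e           ≈⟨ reduce-sound e ⟨
      L (reduce e)  ≡⟨ cong L d≡e ⟨
      L (reduce d)  ≈⟨ reduce-sound d ⟩
      L d           ≈⟨ Ld≋0 ⟩
      0ℤ            ∎)
      where open ≋-Reasoning

    same-sound : ∀ x y → T (same x y) → ⟦ x ⟧ ≡ ⟦ y ⟧
    same-sound (sv p d) (sv q e) = kinds (p ≟ᵏ q)
      where
      kinds : (p≟q : Dec (p ≡ q)) → T (sameKinds p≟q d e) → ⟦ sv p d ⟧ ≡ ⟦ sv q e ⟧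
      kinds (yes refl) h =
        ⟦⟧-cong p d e (L-difference⁻¹ d e (vanishes-sound (d -ᶜ e) h))

    apart-sound : ∀ x y → T (apart x y) → ⟦ x ⟧ ≢ ⟦ y ⟧
    apart-sound (sv p d) (sv q e) = kinds (p ≟ᵏ q)
      where
      kinds : (p≟q : Dec (p ≡ q)) → T (apartKinds p≟q d e) → ⟦ sv p d ⟧ ≢ ⟦ sv q e ⟧
      kinds (no p≢q) _ eq = p≢q (proj₁ (⟦⟧-injective p q d e eq))
      kinds (yes refl) h eq with cases h | proj₂ (⟦⟧-injective p p d e eq)
      ... | inj₁ d-e | d≋e = known-sound (d -ᶜ e) d-e (L-difference d e d≋e)
      ... | inj₂ e-d | d≋e = known-sound (e -ᶜ d) e-d (L-difference e d (≋-sym d≋e))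

    Distinct : SymV × SymV → Set
    Distinct (a , b) = ⟦ a ⟧ ≢ ⟦ b ⟧

    allApart-sound : ∀ ps → T (allApart ps) → All Distinct ps
    allApart-sound ps h =
      All.map (λ {ab} → apart-sound (proj₁ ab) (proj₂ ab)) (T-all (uncurry apart) ps h)

    someSame-clash : ∀ ps → All Distinct ps → ¬ T (someSame ps)
    someSame-clash ps distinct h =
      All.lookupWith (λ {ab} a≢b a≡b → a≢b (same-sound (proj₁ ab) (proj₂ ab) a≡b))
                     distinct (T-any (uncurry same) ps h)

    commonNbr-sound : ∀ x y → T (commonNbr x y) → CommonNbr ⟦ x ⟧ ⟦ y ⟧
    commonNbr-sound x y h with some-nbr x h
    ... | c , xc , h′ with some-nbr c h′
    ... | y′ , cy′ , y′≡y = ⟦ c ⟧ , xc , subst (G ⟦ c ⟧) (same-sound y′ y y′≡y) cy′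

    noCommonNbr-sound : ∀ x y → T (noCommonNbr x y) → ¬ CommonNbr ⟦ x ⟧ ⟦ y ⟧
    noCommonNbr-sound x y h (c , xc , cy) with each-nbr x h xc
    ... | t , refl , h′ with each-nbr t h′ cy
    ... | y′ , y≡y′ , y′≢y = apart-sound y′ y y′≢y (sym y≡y′)

    squareOn-sound : ∀ x y → T (squareOn x y) → OnSquare ⟦ x ⟧ ⟦ y ⟧
    squareOn-sound x y h with some-nbr y h
    ... | c , yc , h′ with some-nbr c h′
    ... | d , cd , h″ with split h″
    ... | closes , distinct
      with some-nbr d closes
         | allApart-sound ((x , y) ∷ (x , c) ∷ (x , d) ∷ (y , c) ∷ (y , d) ∷ (c , d) ∷ []) distinct
    ... | x′ , dx′ , x′≡x | xy ∷ xc ∷ xd ∷ yc′ ∷ yd ∷ cd′ ∷ [] =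
      ⟦ c ⟧ , ⟦ d ⟧ , xy , xc , xd , yc′ , yd , cd′ , yc , cd ,
      subst (G ⟦ d ⟧) (same-sound x′ x x′≡x) dx′

    noSquareOn-sound : ∀ x y → T (noSquareOn x y) → ¬ OnSquare ⟦ x ⟧ ⟦ y ⟧
    noSquareOn-sound x y h (c , d , _ , xc , xd , yc , yd , cd , gyc , gcd , gdx)
      with each-nbr y h gyc
    ... | c′ , refl , h′ with each-nbr c′ h′ gcd
    ... | d′ , refl , h″ with cases h″
    ... | inj₁ degenerate =
      someSame-clash ((x , c′) ∷ (y , c′) ∷ (x , d′) ∷ (y , d′) ∷ (c′ , d′) ∷ [])
                     (xc ∷ yc ∷ xd ∷ yd ∷ cd ∷ []) degenerate
    ... | inj₂ h‴ with each-nbr d′ h‴ gdx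
    ... | x′ , x≡x′ , x′≢x = apart-sound x′ x x′≢x (sym x≡x′)

    portWalk-sound : ∀ m x y → T (portWalk m x y) → PortWalk m ⟦ x ⟧ ⟦ y ⟧
    portWalk-sound ℕ.zero x y h with some-nbr x h
    ... | z , xz , h′ with split h′
    ... | ncn , z≡y with same-sound z y z≡y
    ... | eq = exit (subst (λ b → ¬ CommonNbr ⟦ x ⟧ b) eq (noCommonNbr-sound x z ncn))
                    (subst (G ⟦ x ⟧) eq xz)
    portWalk-sound (ℕ.suc m) x y h with some-nbr x h
    ... | z , xz , h′ with split h′
    ... | ncn , h″ with some-nbr z h″
    ... | t , zt , h‴ with split h‴
    ... | x≢t , walk = turn (noCommonNbr-sound x z ncn) xz zt (apart-sound x t x≢t)
                            (portWalk-sound m t y walk)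

    noPortWalk-sound : ∀ m x y → T (noPortWalk m x y) → ¬ PortWalk m ⟦ x ⟧ ⟦ y ⟧
    noPortWalk-sound ℕ.zero x y h (exit ncn xy) with each-nbr x h xy
    ... | z , y≡z , h′ with cases h′
    ... | inj₁ cn  = ncn (subst (CommonNbr ⟦ x ⟧) (sym y≡z) (commonNbr-sound x z cn))
    ... | inj₂ z≢y = apart-sound z y z≢y (sym y≡z)
    noPortWalk-sound (ℕ.suc m) x y h (turn ncn xb bc x≢c walk) with each-nbr x h xb
    ... | z , refl , h′ with cases h′
    ... | inj₁ cn = ncn (commonNbr-sound x z cn)
    ... | inj₂ h″ with each-nbr z h″ bc
    ... | t , refl , h‴ with cases h‴
    ... | inj₁ x≡t   = x≢c (same-sound x t x≡t)
    ... | inj₂ none  = noPortWalk-sound m t y none walk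

  everyNbr : ∀ (P : V k → V k → Set) {p : SymV → Bool} x →
    (∀ t → T (p t) → P ⟦ x ⟧ ⟦ t ⟧) → T (all p (nbrs x)) → ∀ y → G ⟦ x ⟧ y → P ⟦ x ⟧ y
  everyNbr P x sound h y xy with each-nbr x h xy
  ... | t , refl , pt = sound t pt

  u₀ v₀ : SymV
  u₀ = sv ku 𝟎
  v₀ = sv kv 𝟎

  reach-symbolic : ∀ {x y} → Star G x y →
                   Σ SymV (λ t → x ≡ ⟦ t ⟧) → Σ SymV λ t → y ≡ ⟦ t ⟧
  reach-symbolic ε              p          = p
  reach-symbolic (xz ◅ reach) (t , refl) with adj-nbrs t xz
  ... | t′ , _ , z≡t′ = reach-symbolic reach (t′ , z≡t′)

  connected⇒generated : Connected k r s → Σ Coeffs λ d → 1ℤ ≋ L d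
  connected⇒generated conn with reach-symbolic (conn ⟦ u₀ ⟧ (u (idx 1ℤ))) (u₀ , refl)
  ... | sv p d , eq = d , idx-injective (proj₂ (vertex-injective ku p eq))

  torsion : Connected k r s → ∀ m → m · K ≋ 0ℤ → m · R ≋ 0ℤ → m · S ≋ 0ℤ → m ≋ 0ℤ
  torsion conn m mK mR mS with connected⇒generated conn
  ... | (a , b , c) , 1≋L = begin
    m                                         ≡⟨ ℤP.*-identityʳ m ⟨
    m · 1ℤ                                    ≈⟨ ≋-* m 1≋L ⟩
    m · (a · K ⊹ b · R ⊹ c · S)               ≡⟨ distribute m a b c K R S ⟩
    a · (m · K) ⊹ b · (m · R) ⊹ c · (m · S)   ≈⟨ ≋-+ (≋-+ (≋-* a mK) (≋-* b mR)) (≋-* c mS) ⟩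
    a · 0ℤ ⊹ b · 0ℤ ⊹ c · 0ℤ                  ≡⟨ vanish a b c ⟩
    0ℤ                                        ∎
    where
    open ≋-Reasoning
    distribute : ∀ m a b c K R S →
      m · (a · K ⊹ b · R ⊹ c · S) ≡ a · (m · K) ⊹ b · (m · R) ⊹ c · (m · S)
    distribute = solve-∀
    vanish : ∀ a b c → a · 0ℤ ⊹ b · 0ℤ ⊹ c · 0ℤ ≡ 0ℤ
    vanish = solve-∀

  parity-sound : ∀ a → parity a · K ≋ a · K
  parity-sound a = ≋-sym (begin
    a · K                                ≡⟨ cong (_· K) (a≡a%ℕn+[a/ℕn]*n a 2) ⟩
    (parity a ⊹ (a /ℕ 2) · + 2) · K      ≡⟨ regroup (parity a) (a /ℕ 2) K ⟩
    parity a · K ⊹ (a /ℕ 2) · (K ⊹ K)    ≈⟨ ≋-+ (≋-refl {parity a · K}) (≋-* (a /ℕ 2) K+K≋0) ⟩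
    parity a · K ⊹ (a /ℕ 2) · 0ℤ         ≡⟨ drop (parity a) (a /ℕ 2) K ⟩
    parity a · K                         ∎)
    where
    open ≋-Reasoning
    regroup : ∀ p q K → (p ⊹ q · + 2) · K ≡ p · K ⊹ q · (K ⊹ K)
    regroup = solve-∀
    drop : ∀ p q K → p · K ⊹ q · 0ℤ ≡ p · K
    drop = solve-∀

  k<n : k ℕ.< n
  k<n = ℕP.m<m+n k ℕ.z<s

  K≉0 : ¬ K ≋ 0ℤ
  K≉0 = nonzero-residue ℕ.z<s k<n

  ι≉0 : ∀ i → toℕ i ≢ 0 → ¬ ι i ≋ 0ℤ
  ι≉0 i = residue-≢ (FP.toℕ<n i) ℕ.z<s

  ι≉K : ∀ i → toℕ i ≢ k → ¬ ι i ≋ K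
  ι≉K i = residue-≢ (FP.toℕ<n i) k<n

  ι≉ι : ∀ {i j} → i ≢ j → ¬ ι i ≋ ι j
  ι≉ι i≢j i≋j = i≢j (ι-injective i≋j)

  fact : ∀ e {X} → L e ≡ X → ¬ X ≋ 0ℤ → ¬ L e ≋ 0ℤ
  fact e eq X≉0 e≋0 = X≉0 (subst (_≋ 0ℤ) eq e≋0)

  fact-− : ∀ d e {X Y} → L d ≡ X → L e ≡ Y → ¬ X ≋ Y → ¬ L (d -ᶜ e) ≋ 0ℤ
  fact-− d e refl refl X≉Y d-e≋0 = X≉Y (L-difference⁻¹ d e d-e≋0)

  small≉0 : 9 ≤ k → ∀ m → 0 ℕ.< m → m ℕ.≤ 9 → ¬ + m ≋ 0ℤ
  small≉0 9≤k m 0<m m≤9 = nonzero-residue 0<m (ℕP.≤-<-trans (ℕP.≤-trans m≤9 9≤k) k<n)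

  module GenericCase (r≢0 : toℕ r ≢ 0) (s≢0 : toℕ s ≢ 0)
                     (r≢k : toℕ r ≢ k) (s≢k : toℕ s ≢ k) (r≢s : r ≢ s) where

    sound : Sound normaliser-generic
    sound = record
      { reduce-sound = λ { (a , b , c) →
          ≋-+ (≋-+ (parity-sound a) (≋-refl {b · R})) (≋-refl {c · S}) }
      ; facts-sound =
          fact eK L-eK K≉0 ∷ fact eR L-eR (ι≉0 r r≢0) ∷ fact eS L-eS (ι≉0 s s≢0) ∷
          fact-− eR eK L-eR L-eK (ι≉K r r≢k) ∷ fact-− eS eK L-eS L-eK (ι≉K s s≢k) ∷
          fact-− eR eS L-eR L-eS (ι≉ι r≢s) ∷ [] }

    open Checks normaliser-generic
    open Soundness sound

    girth : VertexTransitive k r s → GirthAtLeast5 k r s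
    girth vt =
      noTriangle-from (homogeneous vt (¬-invariant commonNbr-invariant) ⟦ u₀ ⟧
        (everyNbr (λ a b → ¬ CommonNbr a b) u₀ (noCommonNbr-sound u₀) _)) ,
      noSquare-from (homogeneous vt (¬-invariant onSquare-invariant) ⟦ u₀ ⟧
        (everyNbr (λ a b → ¬ OnSquare a b) u₀ (noSquareOn-sound u₀) _))

  even·K≋0 : ∀ q → (q ⊹ q) · K ≋ 0ℤ
  even·K≋0 q = begin
    (q ⊹ q) · K   ≡⟨ regroup q K ⟩
    q · (K ⊹ K)   ≈⟨ ≋-* q K+K≋0 ⟩
    q · 0ℤ        ≡⟨ ℤP.*-zeroʳ q ⟩
    0ℤ            ∎
    where
    open ≋-Reasoning
    regroup : ∀ q K → (q ⊹ q) · K ≡ q · (K ⊹ K)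
    regroup = solve-∀

  -- Case r ≡ k: every edge at u₀ lies on a 4-cycle, but the edge v₀ w_s does
  -- not, so T₁(k,r,s) is not vertex-transitive.
  module CaseR≡K (9≤k : 9 ≤ k) (conn : Connected k r s)
                 (r≡k : toℕ r ≡ k) (s≢0 : toℕ s ≢ 0) (s≢k : toℕ s ≢ k) where

    R≋K : R ≋ K
    R≋K = ≋-reflexive (cong +_ r≡k)

    -- connectivity forbids 2s ≡ 0
    2s≉0 : ¬ L (eS +ᶜ eS) ≋ 0ℤ
    2s≉0 2s≋0 = small≉0 9≤k 2 ℕ.z<s (ℕP.≤ᵇ⇒≤ 2 9 _)
      (torsion conn (+ 2) (even·K≋0 1ℤ) (≋-trans (≋-* (+ 2) R≋K) (even·K≋0 1ℤ))
        (subst (_≋ 0ℤ) (L-2s K R S) 2s≋0))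
      where
      L-2s : ∀ K R S → 0ℤ · K ⊹ 0ℤ · R ⊹ + 2 · S ≡ + 2 · S
      L-2s = solve-∀

    sound : Sound normaliser-r≡k
    sound = record
      { reduce-sound = λ { (a , b , c) → let open ≋-Reasoning in begin
          parity (a ⊹ b) · K ⊹ 0ℤ · R ⊹ c · S
            ≈⟨ ≋-+ (≋-+ (parity-sound (a ⊹ b)) (≋-refl {0ℤ · R})) (≋-refl {c · S}) ⟩
          (a ⊹ b) · K ⊹ 0ℤ · R ⊹ c · S
            ≡⟨ merge a b c K R S ⟩
          a · K ⊹ b · K ⊹ c · S
            ≈⟨ ≋-+ (≋-+ (≋-refl {a · K}) (≋-* b (≋-sym R≋K))) (≋-refl {c · S}) ⟩
          a · K ⊹ b · R ⊹ c · S ∎ }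
      ; facts-sound =
          fact eK L-eK K≉0 ∷ fact eS L-eS (ι≉0 s s≢0) ∷
          fact-− eS eK L-eS L-eK (ι≉K s s≢k) ∷ 2s≉0 ∷ [] }
      where
      merge : ∀ a b c K R S → (a ⊹ b) · K ⊹ 0ℤ · R ⊹ c · S ≡ a · K ⊹ b · K ⊹ c · S
      merge = solve-∀

    open Checks normaliser-r≡k
    open Soundness sound

    not-vertex-transitive : ¬ VertexTransitive k r s
    not-vertex-transitive vt = noSquareOn-sound v₀ wₛ _ (onSquare ⟦ v₀ ⟧ ⟦ wₛ ⟧ v₀wₛ)
      where
      wₛ : SymV
      wₛ = sv kw (𝟎 +ᶜ eS)
      v₀wₛ : G ⟦ v₀ ⟧ ⟦ wₛ ⟧
      v₀wₛ = All.lookup (nbrs-adj v₀) (there (there (here refl)))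
      onSquare : ∀ x y → G x y → OnSquare x y
      onSquare = homogeneous vt onSquare-invariant ⟦ u₀ ⟧
                   (everyNbr OnSquare u₀ (squareOn-sound u₀) _)

  -- Case r ≡ 0: every vertex lies on the triangle u_i v_i w_i.  At u₀ each
  -- triangle edge starts a port walk of length 3 back to u₀, but the
  -- triangle edge v₀ w₀ admits none, so T₁(k,r,s) is not vertex-transitive.
  module CaseR≡0 (9≤k : 9 ≤ k) (conn : Connected k r s)
                 (r≡0 : toℕ r ≡ 0) (s≢0 : toℕ s ≢ 0) where

    R≋0 : R ≋ 0ℤ
    R≋0 = ≋-reflexive (cong +_ r≡0)

    m·R≋0 : ∀ m → m · R ≋ 0ℤ
    m·R≋0 m = ≋-trans (≋-* m R≋0) (≋-reflexive (ℤP.*-zeroʳ m))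

    -- connectivity forbids 3s ≡ k and 4s ≡ 0
    3s-k≉0 : ¬ L (eS +ᶜ eS +ᶜ eS -ᶜ eK) ≋ 0ℤ
    3s-k≉0 3s-k≋0 = small≉0 9≤k 6 ℕ.z<s (ℕP.≤ᵇ⇒≤ 6 9 _)
      (torsion conn (+ 6) (even·K≋0 (+ 3)) (m·R≋0 (+ 6)) (begin
        + 6 · S                                          ≡⟨ six-s K R S ⟩
        + 2 · (-1ℤ · K ⊹ 0ℤ · R ⊹ + 3 · S) ⊹ (1ℤ ⊹ 1ℤ) · K
          ≈⟨ ≋-+ (≋-* (+ 2) 3s-k≋0) (even·K≋0 1ℤ) ⟩
        + 2 · 0ℤ ⊹ 0ℤ                                    ≡⟨⟩
        0ℤ                                               ∎))
      where
      open ≋-Reasoning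
      six-s : ∀ K R S → + 6 · S ≡ + 2 · (-1ℤ · K ⊹ 0ℤ · R ⊹ + 3 · S) ⊹ (1ℤ ⊹ 1ℤ) · K
      six-s = solve-∀

    4s≉0 : ¬ L (eS +ᶜ eS +ᶜ eS +ᶜ eS) ≋ 0ℤ
    4s≉0 4s≋0 = small≉0 9≤k 4 ℕ.z<s (ℕP.≤ᵇ⇒≤ 4 9 _)
      (torsion conn (+ 4) (even·K≋0 (+ 2)) (m·R≋0 (+ 4))
        (subst (_≋ 0ℤ) (L-4s K R S) 4s≋0))
      where
      L-4s : ∀ K R S → 0ℤ · K ⊹ 0ℤ · R ⊹ + 4 · S ≡ + 4 · S
      L-4s = solve-∀

    sound : Sound normaliser-r≡0
    sound = record
      { reduce-sound = λ { (a , b , c) → let open ≋-Reasoning in begin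
          parity a · K ⊹ 0ℤ · R ⊹ c · S
            ≈⟨ ≋-+ (≋-+ (parity-sound a) (≋-refl {0ℤ · R})) (≋-refl {c · S}) ⟩
          a · K ⊹ 0ℤ · R ⊹ c · S
            ≡⟨ rearrange a b c K R S ⟩
          a · K ⊹ b · 0ℤ ⊹ c · S
            ≈⟨ ≋-+ (≋-+ (≋-refl {a · K}) (≋-* b (≋-sym R≋0))) (≋-refl {c · S}) ⟩
          a · K ⊹ b · R ⊹ c · S ∎ }
      ; facts-sound =
          fact eK L-eK K≉0 ∷ fact eS L-eS (ι≉0 s s≢0) ∷ 3s-k≉0 ∷ 4s≉0 ∷ [] }
      where
      rearrange : ∀ a b c K R S → a · K ⊹ 0ℤ · R ⊹ c · S ≡ a · K ⊹ b · 0ℤ ⊹ c · S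
      rearrange = solve-∀

    open Checks normaliser-r≡0
    open Soundness sound

    walks-at-u₀ : ∀ t → T (noCommonNbr u₀ t ∨ portWalk 3 t u₀) →
                  CommonNbr ⟦ u₀ ⟧ ⟦ t ⟧ → PortWalk 3 ⟦ t ⟧ ⟦ u₀ ⟧
    walks-at-u₀ t h common with cases h
    ... | inj₁ none = ⊥-elim (noCommonNbr-sound u₀ t none common)
    ... | inj₂ walk = portWalk-sound 3 t u₀ walk

    not-vertex-transitive : ¬ VertexTransitive k r s
    not-vertex-transitive vt =
      noPortWalk-sound 3 w₀ v₀ _ (walks ⟦ v₀ ⟧ ⟦ w₀ ⟧ v₀w₀ (commonNbr-sound v₀ w₀ _))
      where
      w₀ : SymV
      w₀ = sv kw (𝟎 +ᶜ eR)
      v₀w₀ : G ⟦ v₀ ⟧ ⟦ w₀ ⟧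
      v₀w₀ = All.lookup (nbrs-adj v₀) (there (here refl))
      walks : ∀ x y → G x y → CommonNbr x y → PortWalk 3 y x
      walks = homogeneous vt
                (→-invariant commonNbr-invariant (flip-invariant (portWalk-invariant 3))) ⟦ u₀ ⟧
                (everyNbr (λ a b → CommonNbr a b → PortWalk 3 b a) u₀ walks-at-u₀ _)

-- T₁(k,r,s) and T₁(k,s,r) are the same graph
swap-edge : ∀ {k} {r s : Fin (k + k)} {x y} → E k r s x y → E k s r x y
swap-edge (uu i)  = uu i
swap-edge (uv i)  = uv i
swap-edge (uw i)  = uw i
swap-edge (vwr i) = vws i
swap-edge (vws i) = vwr i

swap-adj : ∀ {k} {r s : Fin (k + k)} {x y} → Adj k r s x y → Adj k s r x y
swap-adj = Data.Sum.map swap-edge swap-edge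

swap-connected : ∀ {k} {r s : Fin (k + k)} → Connected k r s → Connected k s r
swap-connected conn x y = Star.map swap-adj (conn x y)

swap-vertex-transitive : ∀ {k} {r s : Fin (k + k)} →
                         VertexTransitive k r s → VertexTransitive k s r
swap-vertex-transitive vt x y with vt x y
... | f , aut , fx≡y = f , (λ a b → swap-adj ∘ proj₁ (aut a b) ∘ swap-adj ,
                                    swap-adj ∘ proj₂ (aut a b) ∘ swap-adj) , fx≡y

distinct-values : ∀ {n m} {r s : Fin n} → r ≢ s → toℕ r ≡ m → toℕ s ≢ m
distinct-values r≢s r≡m s≡m = r≢s (FP.toℕ-injective (trans r≡m (sym s≡m)))

lemma4p6 : (k : ℕ) → 9 ≤ k → (r s : Fin (k + k)) → r ≢ s →
    Connected k r s → Simple k r s → VertexTransitive k r s →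
    GirthAtLeast5 k r s
lemma4p6 ℕ.zero () r s r≢s conn _ vt
lemma4p6 k@(ℕ.suc k′) 9≤k r s r≢s conn _ vt
  with toℕ r ℕ.≟ 0 | toℕ s ℕ.≟ 0 | toℕ r ℕ.≟ k | toℕ s ℕ.≟ k
... | yes r≡0 | _ | _ | _ = ⊥-elim
  (Model.CaseR≡0.not-vertex-transitive k′ r s 9≤k conn r≡0 (distinct-values r≢s r≡0) vt)
... | no r≢0 | yes s≡0 | _ | _ = ⊥-elim
  (Model.CaseR≡0.not-vertex-transitive k′ s r 9≤k (swap-connected conn) s≡0 r≢0
    (swap-vertex-transitive vt))
... | no _ | no s≢0 | yes r≡k | _ = ⊥-elim
  (Model.CaseR≡K.not-vertex-transitive k′ r s 9≤k conn r≡k s≢0 (distinct-values r≢s r≡k) vt)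
... | no r≢0 | no _ | no r≢k | yes s≡k = ⊥-elim
  (Model.CaseR≡K.not-vertex-transitive k′ s r 9≤k (swap-connected conn) s≡k r≢0 r≢k
    (swap-vertex-transitive vt))
... | no r≢0 | no s≢0 | no r≢k | no s≢k =
  Model.GenericCase.girth k′ r s r≢0 s≢0 r≢k s≢k r≢s vt
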